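{- Let $G$ be a graph and $n\ge 1$. If $\mathfrak{Zir}(G)\cong\mathfrak{Zir}(P_n)$, then $G\cong P_n$. If $\mathfrak{Zir}(G)\cong\mathfrak{Zir}(K_{1,n-1})$, then $G\cong K_{1,n-1}$.
   Context: All graphs are finite, simple, undirected, with nonempty vertex set. A fort of $G$ is a nonempty $F\subseteq V(G)$ such that $|F\cap N(v)|\ne 1$ for every $v\in V(G)\setminus F$. For $T\subseteq V(G)$ and $x\in T$, a fort $F$ is a private fort of $x$ relative to $T$ if $T\cap F=\{x\}$; $T$ is a $\operatorname{Z}$-irredundant set (ZIr-set) if every element of $T$ has a private fort relative to $T$. The zero forcing irredundance TAR graph $\mathfrak{Zir}(G)$ has as vertices all ZIr-sets of $G$ (including the empty set), two adjacent iff their symmetric difference has exactly one element. $P_n$ is the path and $K_{1,n-1}$ the star on $n$ vertices. -}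

module Defs where

open import Data.Nat using (ℕ; suc; _≡ᵇ_)
open import Data.Bool using (Bool; true; false; _∨_; _xor_)
open import Data.Fin using (Fin; toℕ)
open import Data.Fin.Subset using (Subset; _∈_; _∉_; _∩_; ∣_∣; ⁅_⁆; Nonempty)
open import Data.Vec using (tabulate)
open import Data.Product using (Σ; ∃; _×_)
open import Relation.Binary.PropositionalEquality using (_≡_; _≢_; refl)
open import Data.Bool.Properties using (∨-comm)
open import Data.Vec using (zipWith)
open import Function using (_⇔_)

record Graph (n : ℕ) : Set where
  field
    adj   : Fin n → Fin n → Bool
    sym   : ∀ u v → adj u v ≡ adj v u
    irrefl : ∀ v → adj v v ≡ false
open Graph public

record _≅_ {m n : ℕ} (G : Graph m) (H : Graph n) : Set where
  field
    to      : Fin m → Fin n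
    from    : Fin n → Fin m
    from-to : ∀ v → from (to v) ≡ v
    to-from : ∀ w → to (from w) ≡ w
    adj-iso : ∀ u v → adj G u v ≡ adj H (to u) (to v)

N : ∀ {n} (G : Graph n) → Fin n → Subset n
N G v = tabulate (adj G v)

IsFort : ∀ {n} (G : Graph n) → Subset n → Set
IsFort G F = Nonempty F × (∀ v → v ∉ F → ∣ F ∩ N G v ∣ ≢ 1)

IsPrivateFort : ∀ {n} (G : Graph n) → Subset n → Fin _ → Subset n → Set
IsPrivateFort {n} G T x F = IsFort G F × (T ∩ F ≡ ⁅ x ⁆)

IsZIr : ∀ {n} (G : Graph n) → Subset n → Set
IsZIr G T = ∀ x → x ∈ T → ∃ λ F → IsPrivateFort G T x F

_△_ : ∀ {n} → Subset n → Subset n → Subset n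
_△_ = zipWith _xor_

ZirAdj : ∀ {n} → Subset n → Subset n → Set
ZirAdj S T = ∣ S △ T ∣ ≡ 1

-- Isomorphism 𝔷𝔦𝔯(G) ≅ 𝔷𝔦𝔯(H): the TAR graph has vertex set the ZIr-sets and
-- adjacency ZirAdj.
record ZirIso {m n : ℕ} (G : Graph m) (H : Graph n) : Set where
  field
    f       : Subset m → Subset n
    g       : Subset n → Subset m
    f-ZIr   : ∀ S → IsZIr G S → IsZIr H (f S)
    g-ZIr   : ∀ T → IsZIr H T → IsZIr G (g T)
    g-f     : ∀ S → IsZIr G S → g (f S) ≡ S
    f-g     : ∀ T → IsZIr H T → f (g T) ≡ T
    adj-iso : ∀ S S' → IsZIr G S → IsZIr G S' → ZirAdj S S' ⇔ ZirAdj (f S) (f S')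

suc≢ᵇself : ∀ k → (suc k ≡ᵇ k) ≡ false
suc≢ᵇself ℕ.zero = refl
suc≢ᵇself (suc k) = suc≢ᵇself k

P : (n : ℕ) → Graph n
P n = record { adj = a ; sym = s ; irrefl = ir }
  where
  a : Fin n → Fin n → Bool
  a i j = (suc (toℕ i) ≡ᵇ toℕ j) ∨ (suc (toℕ j) ≡ᵇ toℕ i)
  s : ∀ u v → a u v ≡ a v u
  s u v = ∨-comm (suc (toℕ u) ≡ᵇ toℕ v) _
  ir : ∀ v → a v v ≡ false
  ir v rewrite suc≢ᵇself (toℕ v) = refl

K1 : (n : ℕ) → Graph n
K1 n = record { adj = a ; sym = s ; irrefl = ir }
  where
  z : Fin n → Bool
  z i = toℕ i ≡ᵇ 0
  a : Fin n → Fin n → Bool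
  a i j = z i xor z j
  s : ∀ u v → a u v ≡ a v u
  s u v with z u | z v
  ... | true  | true  = refl
  ... | true  | false = refl
  ... | false | true  = refl
  ... | false | false = refl
  ir : ∀ v → a v v ≡ false
  ir v with z v
  ... | true  = refl
  ... | false = refl

{-# OPTIONS --safe #-}

-- Call x and y incomparable when some fort contains x but not y and another contains y but
-- not x; a two-element set is Z-irredundant exactly when its elements are incomparable.
-- An end of Pₙ and the centre of K₁,ₙ₋₁ are comparable to every vertex, so their singletons
-- have ∅ as only neighbour in the TAR graph, while in a graph with at least two vertices a
-- Z-irredundant set with a single neighbour is a singleton next to ∅. An isomorphism
-- 𝔷𝔦𝔯(G) ≅ 𝔷𝔦𝔯(H) therefore fixes ∅, maps singletons to singletons, and so induces a bijection
-- of vertices preserving incomparability. Both ends of Pₙ lie in every fort while its interior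
-- vertices are pairwise incomparable; in G this profile forces a vertex into every fort, and a
-- graph with such a vertex is a path starting there (the vertex is pendant, and its neighbour
-- lies in every fort once it is deleted). The centre of a star is comparable to everything and
-- its leaves are pairwise incomparable, which forces every other vertex of G to be pendant at
-- the centre. On at most three vertices, having no incomparable pair already forces a vertex
-- into every fort.

module Submission where

open import Defs hiding (sym)
open import Data.Nat using (ℕ; suc)
open import Data.Product using (_×_)

open import Data.Bool using (Bool; true; false; _∨_; _xor_)
open import Data.Bool.Properties as Bool using (not-involutive; xor-identityˡ; xor-identityʳ; ¬-not)
open import Data.Empty using (⊥-elim)
import Data.Empty
open import Data.Fin as Fin using (Fin; zero; suc; toℕ; fromℕ; inject₁; punchIn; punchOut)
open import Data.Fin.Permutation as Permutation
  using (Permutation; _⟨$⟩ʳ_; _⟨$⟩ˡ_; permutation; flip; ↔⇒≡; insert; insert-punchIn; inverseˡ; inverseʳ)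
open import Data.Fin.Properties
  using (_≟_; any?; all?; pigeonhole; punchInᵢ≢i; punchIn-punchOut; punchIn-injective; suc-injective; toℕ-inject₁)
open import Data.Fin.Subset using (Subset; _∈_; _∉_; _⊆_; _∩_; _∪_; ∁; ⊥; ⊤; ⁅_⁆; ∣_∣; Nonempty)
open import Data.Fin.Subset.Properties
open import Data.Nat using (zero; _≡ᵇ_; _≤_; z≤n; s≤s)
import Data.Nat.Properties as ℕ
open import Data.Product as Product using (Σ; ∃; ∃₂; _,_; proj₁; proj₂)
open import Data.Sum using (_⊎_; inj₁; inj₂; [_,_]) renaming (map to ⊎-map)
open import Data.Vec using ([]; _∷_; here; there; lookup; tabulate; insertAt)
open import Data.Vec.Properties
  using (zipWith-identityˡ; zipWith-identityʳ; lookup∘tabulate; []=⇒lookup; lookup⇒[]=; tabulate-cong;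
         insertAt-lookup; insertAt-punchIn)
open import Function using (_∘_; id; _⇔_; Equivalence; mk⇔; case_of_)
open import Function.Properties.Equivalence using () renaming (sym to ⇔-sym)
open import Relation.Binary.PropositionalEquality
  using (_≡_; _≢_; refl; sym; trans; cong; cong₂; subst; subst₂; module ≡-Reasoning)
open import Relation.Nullary using (¬_; Dec; yes; no; does)
open import Relation.Nullary.Decidable using (map′; _×-dec_; _→-dec_)

private
  variable
    m n k : ℕ

∣p∣≡0⇒p≡⊥ : (p : Subset n) → ∣ p ∣ ≡ 0 → p ≡ ⊥
∣p∣≡0⇒p≡⊥ []          _  = refl
∣p∣≡0⇒p≡⊥ (false ∷ p) eq = cong (false ∷_) (∣p∣≡0⇒p≡⊥ p eq)

∣p∣≡1⇒p≡⁅x⁆ : (p : Subset n) → ∣ p ∣ ≡ 1 → ∃ λ x → p ≡ ⁅ x ⁆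
∣p∣≡1⇒p≡⁅x⁆ (true ∷ p)  eq = zero , cong (true ∷_) (∣p∣≡0⇒p≡⊥ p (ℕ.suc-injective eq))
∣p∣≡1⇒p≡⁅x⁆ (false ∷ p) eq = Product.map suc (cong (false ∷_)) (∣p∣≡1⇒p≡⁅x⁆ p eq)

⁅⁆-injective : {x y : Fin n} → ⁅ x ⁆ ≡ ⁅ y ⁆ → x ≡ y
⁅⁆-injective {x = x} {y} eq = x∈⁅y⁆⇒x≡y y (subst (x ∈_) eq (x∈⁅x⁆ x))

pair : Fin n → Fin n → Subset n
pair x y = ⁅ x ⁆ ∪ ⁅ y ⁆

x∈pair : (x y : Fin n) → x ∈ pair x y
x∈pair x y = x∈p∪q⁺ (inj₁ (x∈⁅x⁆ x))

y∈pair : (x y : Fin n) → y ∈ pair x y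
y∈pair x y = x∈p∪q⁺ (inj₂ (x∈⁅x⁆ y))

∈pair⁻ : {x y z : Fin n} → z ∈ pair x y → z ≡ x ⊎ z ≡ y
∈pair⁻ {x = x} {y} z∈ = ⊎-map (x∈⁅y⁆⇒x≡y x) (x∈⁅y⁆⇒x≡y y) (x∈p∪q⁻ ⁅ x ⁆ ⁅ y ⁆ z∈)

∉pair : {x y z : Fin n} → z ≢ x → z ≢ y → z ∉ pair x y
∉pair z≢x z≢y z∈ = [ z≢x , z≢y ] (∈pair⁻ z∈)

pair-comm : (x y : Fin n) → pair x y ≡ pair y x
pair-comm x y = ∪-comm ⁅ x ⁆ ⁅ y ⁆

⊥△p≡p : (p : Subset n) → ⊥ △ p ≡ p
⊥△p≡p = zipWith-identityˡ xor-identityˡ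

p△⊥≡p : (p : Subset n) → p △ ⊥ ≡ p
p△⊥≡p = zipWith-identityʳ xor-identityʳ

p△p≡⊥ : (p : Subset n) → p △ p ≡ ⊥
p△p≡⊥ []          = refl
p△p≡⊥ (false ∷ p) = cong (false ∷_) (p△p≡⊥ p)
p△p≡⊥ (true ∷ p)  = cong (false ∷_) (p△p≡⊥ p)

△-cancelˡ : (p q : Subset n) → p △ (p △ q) ≡ q
△-cancelˡ []          []      = refl
△-cancelˡ (false ∷ p) (b ∷ q) = cong (b ∷_) (△-cancelˡ p q)
△-cancelˡ (true ∷ p)  (b ∷ q) = cong₂ _∷_ (not-involutive b) (△-cancelˡ p q)

⁅x⁆△⁅y⁆≡pair : {x y : Fin n} → x ≢ y → ⁅ x ⁆ △ ⁅ y ⁆ ≡ pair x y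
⁅x⁆△⁅y⁆≡pair {x = zero}  {zero}  x≢y = ⊥-elim (x≢y refl)
⁅x⁆△⁅y⁆≡pair {x = zero}  {suc y} _   =
  cong (true ∷_) (trans (⊥△p≡p ⁅ y ⁆) (sym (∪-identityˡ ⁅ y ⁆)))
⁅x⁆△⁅y⁆≡pair {x = suc x} {zero}  _   =
  cong (true ∷_) (trans (p△⊥≡p ⁅ x ⁆) (sym (∪-identityʳ ⁅ x ⁆)))
⁅x⁆△⁅y⁆≡pair {x = suc x} {suc y} x≢y = cong (false ∷_) (⁅x⁆△⁅y⁆≡pair (x≢y ∘ cong suc))

p△⁅x⁆⊆p : {p : Subset n} {x : Fin n} → x ∈ p → p △ ⁅ x ⁆ ⊆ p
p△⁅x⁆⊆p {p = true ∷ p}  here        (there y∈) = there (subst (_ ∈_) (p△⊥≡p p) y∈)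
p△⁅x⁆⊆p {p = true ∷ p}  (there x∈) here        = here
p△⁅x⁆⊆p {p = _ ∷ p}     (there x∈) (there y∈) = there (p△⁅x⁆⊆p x∈ y∈)

-- Forts

Adj : Graph n → Fin n → Fin n → Set
Adj G u v = adj G u v ≡ true

UniqueNeighbourIn : Graph n → Subset n → Fin n → Fin n → Set
UniqueNeighbourIn G F v w = w ∈ F × Adj G v w × (∀ {b} → b ∈ F → Adj G v b → b ≡ w)

Pendant : Graph n → Fin n → Fin n → Set
Pendant G v w = Adj G v w × (∀ {b} → Adj G v b → b ≡ w)

module _ {n} (G : Graph n) where

  Adj-sym : {u v : Fin n} → Adj G u v → Adj G v u
  Adj-sym {u} {v} uv = trans (Graph.sym G v u) uv

  Adj⇒≢ : {u v : Fin n} → Adj G u v → u ≢ v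
  Adj⇒≢ {u} uu refl with trans (sym uu) (irrefl G u)
  ... | ()

  ∈N⇒Adj : {v x : Fin n} → x ∈ N G v → Adj G v x
  ∈N⇒Adj {v} {x} x∈ = trans (sym (lookup∘tabulate (adj G v) x)) ([]=⇒lookup x∈)

  Adj⇒∈N : {v x : Fin n} → Adj G v x → x ∈ N G v
  Adj⇒∈N {v} {x} vx = lookup⇒[]= x (N G v) (trans (lookup∘tabulate (adj G v) x) vx)

  pendant? : (v : Fin n) → Dec (∃ (Pendant G v))
  pendant? v = any? λ w → (adj G v w Bool.≟ true) ×-dec
    map′ (λ h {b} → h b) (λ h b → h) (all? λ b → (adj G v b Bool.≟ true) →-dec (b ≟ w))

  F∩N≡⁅w⁆⇔unique : {F : Subset n} {v w : Fin n} → F ∩ N G v ≡ ⁅ w ⁆ ⇔ UniqueNeighbourIn G F v w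
  F∩N≡⁅w⁆⇔unique {F} {v} {w} = mk⇔ to from
    where
    to : F ∩ N G v ≡ ⁅ w ⁆ → UniqueNeighbourIn G F v w
    to eq = w∈F , ∈N⇒Adj w∈N , λ b∈F vb → x∈⁅y⁆⇒x≡y w (subst (_ ∈_) eq (x∈p∩q⁺ (b∈F , Adj⇒∈N vb)))
      where
      w∈F∩N = subst (w ∈_) (sym eq) (x∈⁅x⁆ w)
      w∈F = proj₁ (x∈p∩q⁻ F (N G v) w∈F∩N)
      w∈N = proj₂ (x∈p∩q⁻ F (N G v) w∈F∩N)
    from : UniqueNeighbourIn G F v w → F ∩ N G v ≡ ⁅ w ⁆
    from (w∈F , vw , unique) = ⊆-antisym
      (λ b∈ → let (b∈F , b∈N) = x∈p∩q⁻ F (N G v) b∈ in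
              subst (_∈ ⁅ w ⁆) (sym (unique b∈F (∈N⇒Adj b∈N))) (x∈⁅x⁆ w))
      (λ b∈ → subst (_∈ F ∩ N G v) (sym (x∈⁅y⁆⇒x≡y w b∈)) (x∈p∩q⁺ (w∈F , Adj⇒∈N vw)))

  isFort⇒¬unique : {F : Subset n} → IsFort G F → ∀ {v w} → v ∉ F → ¬ UniqueNeighbourIn G F v w
  isFort⇒¬unique {F} (_ , fort) {v} {w} v∉F unique =
    fort v v∉F (subst (λ p → ∣ p ∣ ≡ 1) (sym (Equivalence.from F∩N≡⁅w⁆⇔unique unique)) (∣⁅x⁆∣≡1 w))

  ¬unique⇒isFort : {F : Subset n} → Nonempty F → (∀ {v w} → v ∉ F → ¬ UniqueNeighbourIn G F v w) → IsFort G F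
  ¬unique⇒isFort {F} nonempty noUnique = nonempty , λ v v∉F card →
    let (w , eq) = ∣p∣≡1⇒p≡⁅x⁆ (F ∩ N G v) card in noUnique v∉F (Equivalence.to F∩N≡⁅w⁆⇔unique eq)

  ⊤-isFort : Fin n → IsFort G ⊤
  ⊤-isFort x = ¬unique⇒isFort (x , ∈⊤) λ v∉⊤ → ⊥-elim (v∉⊤ ∈⊤)

  noNeighbourIn⇒¬unique : {F : Subset n} {v w : Fin n} →
    (∀ {b} → Adj G v b → b ∉ F) → ¬ UniqueNeighbourIn G F v w
  noNeighbourIn⇒¬unique none (w∈F , vw , _) = none vw w∈F

  twoNeighboursIn⇒¬unique : {F : Subset n} {v a b w : Fin n} →
    a ∈ F → b ∈ F → Adj G v a → Adj G v b → a ≢ b → ¬ UniqueNeighbourIn G F v w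
  twoNeighboursIn⇒¬unique a∈F b∈F va vb a≢b (_ , _ , unique) = a≢b (trans (unique a∈F va) (sym (unique b∈F vb)))

  pendant⇒¬uniqueOutside : {X : Subset n} {x w w′ : Fin n} →
    Pendant G x w → w ∈ X → ¬ UniqueNeighbourIn G (∁ X) x w′
  pendant⇒¬uniqueOutside (_ , unique) w∈X =
    noNeighbourIn⇒¬unique λ xb → x∈p⇒x∉∁p (subst (_∈ _) (sym (unique xb)) w∈X)

  pendant-forces : {F : Subset n} {x w : Fin n} → Pendant G x w → IsFort G F → w ∈ F → x ∈ F
  pendant-forces {F} {x} (xw , unique) fort w∈F with x ∈? F
  ... | yes x∈F = x∈F
  ... | no  x∉F = ⊥-elim (isFort⇒¬unique fort x∉F (w∈F , xw , λ _ → unique))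

  ∁-isFort : {X : Subset n} {y : Fin n} → y ∉ X →
    (∀ {x w} → x ∈ X → ¬ UniqueNeighbourIn G (∁ X) x w) → IsFort G (∁ X)
  ∁-isFort y∉X noUnique = ¬unique⇒isFort (_ , x∉p⇒x∈∁p y∉X) (noUnique ∘ x∉∁p⇒x∈p)

  ∁⁅x⁆-isFort : {x y : Fin n} → y ≢ x → (∀ {w} → ¬ Pendant G x w) → IsFort G (∁ ⁅ x ⁆)
  ∁⁅x⁆-isFort {x} y≢x nonPendant = ∁-isFort (x≢y⇒x∉⁅y⁆ y≢x) λ x′∈ (_ , x′w , unique) →
    case x∈⁅y⁆⇒x≡y x x′∈ of λ where
      refl → nonPendant (x′w , λ xb → unique (x∉p⇒x∈∁p (x≢y⇒x∉⁅y⁆ (Adj⇒≢ xb ∘ sym))) xb)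

  ∁pair-isFort : {x y z : Fin n} → z ≢ x → z ≢ y →
    (∀ {w} → ¬ UniqueNeighbourIn G (∁ (pair x y)) x w) → (∀ {w} → ¬ UniqueNeighbourIn G (∁ (pair x y)) y w) →
    IsFort G (∁ (pair x y))
  ∁pair-isFort z≢x z≢y noUniqueˣ noUniqueʸ = ∁-isFort (∉pair z≢x z≢y) λ v∈ →
    [ (λ { refl → noUniqueˣ }) , (λ { refl → noUniqueʸ }) ] (∈pair⁻ v∈)

  pair-isFort : {x y : Fin n} → Pendant G x y → Pendant G y x → IsFort G (pair x y)
  pair-isFort {x} {y} (_ , uniqueˣ) (_ , uniqueʸ) = ¬unique⇒isFort (x , x∈pair x y) λ v∉ (w∈ , vw , _) →
    [ (λ { refl → v∉ (subst (_∈ _) (sym (uniqueˣ (Adj-sym vw))) (y∈pair x y)) })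
    , (λ { refl → v∉ (subst (_∈ _) (sym (uniqueʸ (Adj-sym vw))) (x∈pair x y)) }) ] (∈pair⁻ w∈)

IsFort-cong : {G H : Graph n} {F : Subset n} → (∀ u v → adj G u v ≡ adj H u v) → IsFort G F → IsFort H F
IsFort-cong {F = F} eq (nonempty , fort) =
  nonempty , λ v v∉F → subst (λ S → ∣ F ∩ S ∣ ≢ 1) (tabulate-cong (eq v)) (fort v v∉F)

-- Incomparable vertices

Separates : Graph n → Fin n → Fin n → Set
Separates G x y = ∃ λ F → IsFort G F × x ∈ F × y ∉ F

Incomparable : Graph n → Fin n → Fin n → Set
Incomparable G x y = Separates G x y × Separates G y x

ComparableToAll : Graph n → Fin n → Set
ComparableToAll G e = ∀ z → ¬ Incomparable G e z

InEveryFort : Graph n → Fin n → Set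
InEveryFort G v = ∀ {F} → IsFort G F → v ∈ F

Incomparable-sym : {G : Graph n} {x y : Fin n} → Incomparable G x y → Incomparable G y x
Incomparable-sym (sxy , syx) = syx , sxy

Incomparable-irrefl : {G : Graph n} {x : Fin n} → ¬ Incomparable G x x
Incomparable-irrefl ((_ , _ , x∈F , x∉F) , _) = x∉F x∈F

Separates⇒≢ : {G : Graph n} {x y : Fin n} → Separates G x y → x ≢ y
Separates⇒≢ (_ , _ , x∈F , y∉F) refl = y∉F x∈F

inEveryFort⇒comparableToAll : {G : Graph n} {e : Fin n} → InEveryFort G e → ComparableToAll G e
inEveryFort⇒comparableToAll e-anchor z (_ , (_ , fort , _ , e∉F)) = e∉F (e-anchor fort)

one-vertex-comparable : (G : Graph 1) → ComparableToAll G zero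
one-vertex-comparable G zero = Incomparable-irrefl {G = G}

module _ {n} (G : Graph n) where

  pendant⇒¬separates : {x w : Fin n} → Pendant G x w → ¬ Separates G w x
  pendant⇒¬separates pendant (_ , fort , w∈F , x∉F) = x∉F (pendant-forces G pendant fort w∈F)

  nonPendant⇒separates : {x y : Fin n} → (∀ {w} → ¬ Pendant G x w) → y ≢ x → Separates G y x
  nonPendant⇒separates {x} {y} nonPendant y≢x =
    ∁ ⁅ x ⁆ , ∁⁅x⁆-isFort G y≢x nonPendant , x∉p⇒x∈∁p (x≢y⇒x∉⁅y⁆ y≢x) , x∈p⇒x∉∁p (x∈⁅x⁆ x)

  -- A K₂ component {x, y} and its complement are both forts.
  component-incomparable : {x y z : Fin n} → Pendant G x y → Pendant G y x → z ≢ x → z ≢ y → Incomparable G x z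
  component-incomparable {x} {y} {z} pˣ pʸ z≢x z≢y =
    (pair x y , pair-isFort G pˣ pʸ , x∈pair x y , ∉pair z≢x z≢y) ,
    (∁ (pair x y) , complement , x∉p⇒x∈∁p (∉pair z≢x z≢y) , x∈p⇒x∉∁p (x∈pair x y))
    where
    complement = ∁pair-isFort G z≢x z≢y
      (pendant⇒¬uniqueOutside G pˣ (y∈pair x y)) (pendant⇒¬uniqueOutside G pʸ (x∈pair x y))

  leaves-separable : {a b c d : Fin n} → Pendant G a c → Pendant G b c → Pendant G d c →
    a ≢ b → a ≢ d → b ≢ d → Separates G a b
  leaves-separable {a} {b} {c} {d} (ac , _) pᵇ (dc , _) a≢b a≢d b≢d =
    ∁ (pair c b) , complement , outside a≢c a≢b , x∈p⇒x∉∁p (y∈pair c b)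
    where
    outside : ∀ {z} → z ≢ c → z ≢ b → z ∈ ∁ (pair c b)
    outside z≢c z≢b = x∉p⇒x∈∁p (∉pair z≢c z≢b)
    a≢c = Adj⇒≢ G ac
    complement = ∁pair-isFort G a≢c a≢b
      (twoNeighboursIn⇒¬unique G (outside a≢c a≢b) (outside (Adj⇒≢ G dc) (b≢d ∘ sym))
        (Adj-sym G ac) (Adj-sym G dc) a≢d)
      (pendant⇒¬uniqueOutside G pᵇ (x∈pair c b))

-- Z-irredundant sets and the TAR graph

module _ {n} (G : Graph n) where

  ⊥-isZIr : IsZIr G ⊥
  ⊥-isZIr x x∈⊥ = ⊥-elim (∉⊥ x∈⊥)

  ⁅x⁆-isZIr : (x : Fin n) → IsZIr G ⁅ x ⁆
  ⁅x⁆-isZIr x y y∈ rewrite x∈⁅y⁆⇒x≡y x y∈ = ⊤ , ⊤-isFort G x , ∩-identityʳ ⁅ x ⁆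

  isZIr-⊆ : {S T : Subset n} → S ⊆ T → IsZIr G T → IsZIr G S
  isZIr-⊆ {S} {T} S⊆T T-ZIr x x∈S = let (F , fort , T∩F≡⁅x⁆) = T-ZIr x (S⊆T x∈S) in
    F , fort , ⊆-antisym
      (λ y∈ → let (y∈S , y∈F) = x∈p∩q⁻ S F y∈ in subst (_ ∈_) T∩F≡⁅x⁆ (x∈p∩q⁺ (S⊆T y∈S , y∈F)))
      (λ y∈ → case x∈⁅y⁆⇒x≡y x y∈ of λ where
        refl → x∈p∩q⁺ (x∈S , proj₂ (x∈p∩q⁻ T F (subst (_ ∈_) (sym T∩F≡⁅x⁆) (x∈⁅x⁆ x)))))

  isZIr⇒separates : {S : Subset n} {x y : Fin n} → IsZIr G S → x ∈ S → y ∈ S → y ≢ x → Separates G x y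
  isZIr⇒separates {S} {x} {y} S-ZIr x∈S y∈S y≢x = let (F , fort , S∩F≡⁅x⁆) = S-ZIr x x∈S in
    F , fort , proj₂ (x∈p∩q⁻ S F (subst (x ∈_) (sym S∩F≡⁅x⁆) (x∈⁅x⁆ x))) ,
    λ y∈F → y≢x (x∈⁅y⁆⇒x≡y x (subst (y ∈_) S∩F≡⁅x⁆ (x∈p∩q⁺ (y∈S , y∈F))))

  isZIr⇒incomparable : {S : Subset n} {x y : Fin n} → IsZIr G S → x ∈ S → y ∈ S → x ≢ y → Incomparable G x y
  isZIr⇒incomparable S-ZIr x∈S y∈S x≢y =
    isZIr⇒separates S-ZIr x∈S y∈S (x≢y ∘ sym) , isZIr⇒separates S-ZIr y∈S x∈S x≢y

  separates⇒privateFort : {x y : Fin n} → Separates G x y → ∃ (IsPrivateFort G (pair x y) x)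
  separates⇒privateFort {x} {y} (F , fort , x∈F , y∉F) = F , fort , ⊆-antisym
    (λ z∈ → let (z∈pair , z∈F) = x∈p∩q⁻ (pair x y) F z∈ in
      [ (λ { refl → x∈⁅x⁆ x }) , (λ { refl → ⊥-elim (y∉F z∈F) }) ] (∈pair⁻ z∈pair))
    (λ z∈ → case x∈⁅y⁆⇒x≡y x z∈ of λ where refl → x∈p∩q⁺ (x∈pair x y , x∈F))

  incomparable⇒isZIr : {x y : Fin n} → Incomparable G x y → IsZIr G (pair x y)
  incomparable⇒isZIr {x} {y} (sxy , syx) z z∈ with ∈pair⁻ z∈
  ... | inj₁ refl = separates⇒privateFort sxy
  ... | inj₂ refl = subst (λ S → ∃ (IsPrivateFort G S z)) (pair-comm z x) (separates⇒privateFort syx)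

ZirAdj⇒toggle : {S T : Subset n} → ZirAdj S T → ∃ λ d → T ≡ S △ ⁅ d ⁆
ZirAdj⇒toggle {S = S} {T} S~T = let (d , S△T≡⁅d⁆) = ∣p∣≡1⇒p≡⁅x⁆ (S △ T) S~T in
  d , trans (sym (△-cancelˡ S T)) (cong (S △_) S△T≡⁅d⁆)

toggle-ZirAdj : (S : Subset n) (d : Fin n) → ZirAdj S (S △ ⁅ d ⁆)
toggle-ZirAdj S d = subst (λ p → ∣ p ∣ ≡ 1) (sym (△-cancelˡ S ⁅ d ⁆)) (∣⁅x⁆∣≡1 d)

ZirAdj-⊥⁅x⁆ : (x : Fin n) → ZirAdj ⊥ ⁅ x ⁆
ZirAdj-⊥⁅x⁆ x = subst (ZirAdj ⊥) (⊥△p≡p ⁅ x ⁆) (toggle-ZirAdj ⊥ x)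

ZirAdj-⁅x⁆-pair : {x y : Fin n} → x ≢ y → ZirAdj ⁅ x ⁆ (pair x y)
ZirAdj-⁅x⁆-pair {x = x} {y} x≢y = subst (ZirAdj ⁅ x ⁆) (⁅x⁆△⁅y⁆≡pair x≢y) (toggle-ZirAdj ⁅ x ⁆ y)

ZirAdj-⊥⇒⁅⁆ : {S : Subset n} → ZirAdj ⊥ S → ∃ λ d → S ≡ ⁅ d ⁆
ZirAdj-⊥⇒⁅⁆ ⊥~S = let (d , S≡) = ZirAdj⇒toggle ⊥~S in d , trans S≡ (⊥△p≡p ⁅ d ⁆)

ZirAdj-⁅⁆ : {S : Subset n} {a : Fin n} → ZirAdj ⁅ a ⁆ S → S ≡ ⊥ ⊎ (a ∈ S × ∃ λ d → d ≢ a × d ∈ S)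
ZirAdj-⁅⁆ {S = S} {a} ⁅a⁆~S with ZirAdj⇒toggle {S = ⁅ a ⁆} {S} ⁅a⁆~S
... | d , refl with d ≟ a
...   | yes refl = inj₁ (p△p≡⊥ ⁅ d ⁆)
...   | no  d≢a  = inj₂ (subst (a ∈_) a-d (x∈pair a d) , d , d≢a , subst (d ∈_) a-d (y∈pair a d))
  where a-d = sym (⁅x⁆△⁅y⁆≡pair (d≢a ∘ sym))

-- Each Y △ ⁅ z ⁆ with z ∈ Y is a neighbour of Y, so Y is a singleton; Y = ⊥ is impossible
-- because ⁅ v₀ ⁆ and ⁅ v₁ ⁆ are distinct neighbours of ⊥.
only-neighbour⇒⊥ : (G : Graph n) {v₀ v₁ : Fin n} → v₀ ≢ v₁ → {X Y : Subset n} → IsZIr G Y →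
  (∀ {S} → IsZIr G S → ZirAdj Y S → S ≡ X) → X ≡ ⊥
only-neighbour⇒⊥ G {v₀} {v₁} v₀≢v₁ {X} {Y} Y-ZIr only with nonempty? Y
... | yes (a , a∈Y) = begin
  X             ≡⟨ sym (toggle≡X a∈Y) ⟩
  Y △ ⁅ a ⁆     ≡⟨ cong (_△ ⁅ a ⁆) Y≡⁅a⁆ ⟩
  ⁅ a ⁆ △ ⁅ a ⁆ ≡⟨ p△p≡⊥ ⁅ a ⁆ ⟩
  ⊥             ∎
  where
  open ≡-Reasoning
  toggle≡X : ∀ {z} → z ∈ Y → Y △ ⁅ z ⁆ ≡ X
  toggle≡X z∈Y = only (isZIr-⊆ G (p△⁅x⁆⊆p z∈Y) Y-ZIr) (toggle-ZirAdj Y _)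
  a≡ : ∀ {z} → z ∈ Y → a ≡ z
  a≡ {z} z∈Y = ⁅⁆-injective (begin
    ⁅ a ⁆             ≡⟨ sym (△-cancelˡ Y ⁅ a ⁆) ⟩
    Y △ (Y △ ⁅ a ⁆)   ≡⟨ cong (Y △_) (trans (toggle≡X a∈Y) (sym (toggle≡X z∈Y))) ⟩
    Y △ (Y △ ⁅ z ⁆)   ≡⟨ △-cancelˡ Y ⁅ z ⁆ ⟩
    ⁅ z ⁆             ∎)
  Y≡⁅a⁆ : Y ≡ ⁅ a ⁆
  Y≡⁅a⁆ = ⊆-antisym (λ z∈Y → subst (_∈ ⁅ a ⁆) (a≡ z∈Y) (x∈⁅x⁆ a))
                    (λ z∈ → subst (_∈ Y) (sym (x∈⁅y⁆⇒x≡y a z∈)) a∈Y)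
... | no Y-empty = ⊥-elim (v₀≢v₁ (⁅⁆-injective (trans (⁅v⁆≡X v₀) (sym (⁅v⁆≡X v₁)))))
  where
  ⁅v⁆≡X : ∀ v → ⁅ v ⁆ ≡ X
  ⁅v⁆≡X v = only (⁅x⁆-isZIr G v) (subst (λ T → ZirAdj T ⁅ v ⁆) (sym (Empty-unique Y-empty)) (ZirAdj-⊥⁅x⁆ v))

record IncIso (G : Graph m) (H : Graph n) : Set where
  field
    bijection : Permutation m n
    preserves : ∀ {x y} → Incomparable G x y → Incomparable H (bijection ⟨$⟩ʳ x) (bijection ⟨$⟩ʳ y)
    reflects  : ∀ {x y} → Incomparable H x y → Incomparable G (bijection ⟨$⟩ˡ x) (bijection ⟨$⟩ˡ y)

IncIso-flip : {G : Graph m} {H : Graph n} → IncIso G H → IncIso H G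
IncIso-flip φ = record { bijection = flip bijection ; preserves = reflects ; reflects = preserves }
  where open IncIso φ

module _ {G : Graph m} {H : Graph n} (I : ZirIso G H) where
  open ZirIso I

  inverse : ZirIso H G
  inverse = record
    { f = g ; g = f ; f-ZIr = g-ZIr ; g-ZIr = f-ZIr ; g-f = f-g ; f-g = g-f
    ; adj-iso = λ T T′ T-ZIr T′-ZIr → ⇔-sym (subst₂ (λ A B → ZirAdj (g T) (g T′) ⇔ ZirAdj A B)
        (f-g T T-ZIr) (f-g T′ T′-ZIr) (adj-iso (g T) (g T′) (g-ZIr T T-ZIr) (g-ZIr T′ T′-ZIr)))
    }

  -- As e is comparable to all vertices, ⊥ is the only neighbour of ⁅ e ⁆ in 𝔷𝔦𝔯(H).
  g⊥≡⊥ : {v₀ v₁ : Fin m} → v₀ ≢ v₁ → {e : Fin n} → ComparableToAll H e → g ⊥ ≡ ⊥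
  g⊥≡⊥ v₀≢v₁ {e} e-comparable = only-neighbour⇒⊥ G v₀≢v₁ (g-ZIr ⁅ e ⁆ ⁅e⁆-ZIr) neighbour≡g⊥
    where
    ⁅e⁆-ZIr = ⁅x⁆-isZIr H e
    neighbour≡g⊥ : ∀ {S} → IsZIr G S → ZirAdj (g ⁅ e ⁆) S → S ≡ g ⊥
    neighbour≡g⊥ {S} S-ZIr e~S with ZirAdj-⁅⁆ (subst (λ T → ZirAdj T (f S)) (f-g ⁅ e ⁆ ⁅e⁆-ZIr)
                                      (Equivalence.to (adj-iso _ S (g-ZIr ⁅ e ⁆ ⁅e⁆-ZIr) S-ZIr) e~S))
    ... | inj₁ fS≡⊥ = trans (sym (g-f S S-ZIr)) (cong g fS≡⊥)
    ... | inj₂ (e∈ , d , d≢e , d∈) =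
      ⊥-elim (e-comparable d (isZIr⇒incomparable H (f-ZIr S S-ZIr) e∈ d∈ (d≢e ∘ sym)))

module VertexMap {G : Graph m} {H : Graph n} (I : ZirIso G H) (f⊥≡⊥ : ZirIso.f I ⊥ ≡ ⊥) where
  open ZirIso I
  open ≡-Reasoning

  image-⁅x⁆ : (x : Fin m) → ∃ λ y → f ⁅ x ⁆ ≡ ⁅ y ⁆
  image-⁅x⁆ x = ZirAdj-⊥⇒⁅⁆ (subst (λ T → ZirAdj T (f ⁅ x ⁆)) f⊥≡⊥
    (Equivalence.to (adj-iso ⊥ ⁅ x ⁆ (⊥-isZIr G) (⁅x⁆-isZIr G x)) (ZirAdj-⊥⁅x⁆ x)))

  σ : Fin m → Fin n
  σ x = proj₁ (image-⁅x⁆ x)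

  f⁅x⁆≡⁅σx⁆ : ∀ x → f ⁅ x ⁆ ≡ ⁅ σ x ⁆
  f⁅x⁆≡⁅σx⁆ x = proj₂ (image-⁅x⁆ x)

  σ-injective : ∀ {x y} → σ x ≡ σ y → x ≡ y
  σ-injective {x} {y} σx≡σy = ⁅⁆-injective (begin
    ⁅ x ⁆       ≡⟨ sym (g-f ⁅ x ⁆ (⁅x⁆-isZIr G x)) ⟩
    g (f ⁅ x ⁆) ≡⟨ cong g (trans (f⁅x⁆≡⁅σx⁆ x) (trans (cong ⁅_⁆ σx≡σy) (sym (f⁅x⁆≡⁅σx⁆ y)))) ⟩
    g (f ⁅ y ⁆) ≡⟨ g-f ⁅ y ⁆ (⁅x⁆-isZIr G y) ⟩
    ⁅ y ⁆       ∎)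

  σ-inverseˡ : {τ : Fin n → Fin m} → (∀ y → g ⁅ y ⁆ ≡ ⁅ τ y ⁆) → ∀ y → σ (τ y) ≡ y
  σ-inverseˡ {τ} g⁅y⁆≡⁅τy⁆ y = ⁅⁆-injective (begin
    ⁅ σ (τ y) ⁆ ≡⟨ sym (f⁅x⁆≡⁅σx⁆ (τ y)) ⟩
    f ⁅ τ y ⁆   ≡⟨ cong f (sym (g⁅y⁆≡⁅τy⁆ y)) ⟩
    f (g ⁅ y ⁆) ≡⟨ f-g ⁅ y ⁆ (⁅x⁆-isZIr H y) ⟩
    ⁅ y ⁆       ∎)

  σ∈f : ∀ {S x} → IsZIr G S → x ∈ S → ZirAdj ⁅ x ⁆ S → σ x ∈ f S
  σ∈f {S} {x} S-ZIr x∈S x~S with ZirAdj-⁅⁆ (subst (λ T → ZirAdj T (f S)) (f⁅x⁆≡⁅σx⁆ x)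
                                   (Equivalence.to (adj-iso ⁅ x ⁆ S (⁅x⁆-isZIr G x) S-ZIr) x~S))
  ... | inj₂ (σx∈fS , _) = σx∈fS
  ... | inj₁ fS≡⊥ = ⊥-elim (∉⊥ (subst (x ∈_) S≡⊥ x∈S))
    where
    S≡⊥ : S ≡ ⊥
    S≡⊥ = begin
      S           ≡⟨ sym (g-f S S-ZIr) ⟩
      g (f S)     ≡⟨ cong g (trans fS≡⊥ (sym f⊥≡⊥)) ⟩
      g (f ⊥)     ≡⟨ g-f ⊥ (⊥-isZIr G) ⟩
      ⊥           ∎

  σ-incomparable : ∀ {x y} → Incomparable G x y → Incomparable H (σ x) (σ y)
  σ-incomparable {x} {y} x≁y = isZIr⇒incomparable H (f-ZIr _ pair-ZIr)
    (σ∈f pair-ZIr (x∈pair x y) (ZirAdj-⁅x⁆-pair x≢y))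
    (σ∈f pair-ZIr (y∈pair x y) (subst (ZirAdj ⁅ y ⁆) (pair-comm y x) (ZirAdj-⁅x⁆-pair (x≢y ∘ sym))))
    (x≢y ∘ σ-injective)
    where
    x≢y = Separates⇒≢ {G = G} (proj₁ x≁y)
    pair-ZIr = incomparable⇒isZIr G x≁y

zirIso⇒incIso : {G : Graph m} {H : Graph n} → ZirIso G H → {v₀ v₁ : Fin m} → v₀ ≢ v₁ →
  {e : Fin n} → ComparableToAll H e → IncIso G H
zirIso⇒incIso {G = G} {H} I v₀≢v₁ e-comparable = record
  { bijection = permutation σ τ (σ-inverseˡ g⁅y⁆≡⁅τy⁆) (τ-inverseˡ f⁅x⁆≡⁅σx⁆)
  ; preserves = σ-incomparable
  ; reflects  = τ-incomparable
  }
  where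
  open ZirIso I
  g⊥ = g⊥≡⊥ I v₀≢v₁ e-comparable
  open VertexMap I (trans (cong f (sym g⊥)) (f-g ⊥ (⊥-isZIr H)))
  open VertexMap (inverse I) g⊥
    renaming (σ to τ; f⁅x⁆≡⁅σx⁆ to g⁅y⁆≡⁅τy⁆; σ-inverseˡ to τ-inverseˡ; σ-incomparable to τ-incomparable)
    using ()

mk≅ : {G : Graph m} {H : Graph n} (π : Permutation m n) →
  (∀ u v → adj G u v ≡ adj H (π ⟨$⟩ʳ u) (π ⟨$⟩ʳ v)) → G ≅ H
mk≅ π adj-iso = record
  { to = π ⟨$⟩ʳ_ ; from = π ⟨$⟩ˡ_ ; from-to = λ _ → inverseˡ π ; to-from = λ _ → inverseʳ π
  ; adj-iso = adj-iso
  }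

≅-sym : {G : Graph m} {H : Graph n} → G ≅ H → H ≅ G
≅-sym {H = H} φ = record
  { to = from ; from = to ; from-to = to-from ; to-from = from-to
  ; adj-iso = λ u v → sym (trans (adj-iso (from u) (from v)) (cong₂ (adj H) (to-from u) (to-from v)))
  }
  where open _≅_ φ

≅-trans : {G : Graph m} {H : Graph n} {K : Graph k} → G ≅ H → H ≅ K → G ≅ K
≅-trans φ ψ = record
  { to = ψ.to ∘ φ.to ; from = φ.from ∘ ψ.from
  ; from-to = λ u → trans (cong φ.from (ψ.from-to (φ.to u))) (φ.from-to u)
  ; to-from = λ w → trans (cong ψ.to (φ.to-from (ψ.from w))) (ψ.to-from w)
  ; adj-iso = λ u v → trans (φ.adj-iso u v) (ψ.adj-iso (φ.to u) (φ.to v))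
  }
  where
  module φ = _≅_ φ
  module ψ = _≅_ ψ

≅-cong : {G : Graph m} {H H′ : Graph n} → (∀ u v → adj H u v ≡ adj H′ u v) → G ≅ H → G ≅ H′
≅-cong eq φ = record
  { to = to ; from = from ; from-to = from-to ; to-from = to-from
  ; adj-iso = λ u v → trans (adj-iso u v) (eq (to u) (to v)) }
  where open _≅_ φ

one-vertex-≅ : (G H : Graph 1) → G ≅ H
one-vertex-≅ G H = mk≅ Permutation.id λ { zero zero → trans (irrefl G zero) (sym (irrefl H zero)) }

pendant-from : {G : Graph m} {H : Graph n} (φ : G ≅ H) {a b : Fin n} →
  Pendant H a b → Pendant G (_≅_.from φ a) (_≅_.from φ b)
pendant-from {H = H} φ {a} {b} (ab , unique) =
  trans (adj-iso (from a) (from b)) (trans (cong₂ (adj H) (to-from a) (to-from b)) ab) ,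
  λ {x} ax → trans (sym (from-to x))
    (cong from (unique (trans (cong₂ (adj H) (sym (to-from a)) refl) (trans (sym (adj-iso (from a) x)) ax))))
  where open _≅_ φ

infixl 25 _─_

_─_ : Graph (suc n) → Fin (suc n) → Graph n
G ─ v = record
  { adj    = λ i j → adj G (punchIn v i) (punchIn v j)
  ; sym    = λ i j → Graph.sym G (punchIn v i) (punchIn v j)
  ; irrefl = λ i → irrefl G (punchIn v i)
  }

data PunchView {n} (v : Fin (suc n)) : Fin (suc n) → Set where
  at      : PunchView v v
  punched : (i : Fin n) → PunchView v (punchIn v i)

punchView : (v u : Fin (suc n)) → PunchView v u
punchView v u with v ≟ u
... | yes refl = at
... | no  v≢u  = subst (PunchView v) (punchIn-punchOut v≢u) (punched (punchOut v≢u))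

insert-self : (i : Fin (suc m)) (j : Fin (suc n)) (π : Permutation m n) → insert i j π ⟨$⟩ʳ i ≡ j
insert-self i j π with i ≟ i
... | yes _   = refl
... | no  i≢i = ⊥-elim (i≢i refl)

≅-extend : {G : Graph (suc m)} {H : Graph (suc n)} {v : Fin (suc m)} {u : Fin (suc n)} (ψ : G ─ v ≅ H ─ u) →
  (∀ i → adj G v (punchIn v i) ≡ adj H u (punchIn u (_≅_.to ψ i))) →
  Σ (G ≅ H) λ φ → _≅_.to φ v ≡ u
≅-extend {G = G} {H} {v} {u} ψ neighbours = mk≅ π adj-iso′ , insert-self v u π₀
  where
  open _≅_ ψ
  π₀ = permutation to from to-from from-to
  π  = insert v u π₀
  π-punchIn : ∀ i → π ⟨$⟩ʳ punchIn v i ≡ punchIn u (to i)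
  π-punchIn = insert-punchIn v u π₀
  adj-iso′ : ∀ a b → adj G a b ≡ adj H (π ⟨$⟩ʳ a) (π ⟨$⟩ʳ b)
  adj-iso′ a b with punchView v a | punchView v b
  ... | at        | at        = trans (irrefl G v) (sym (irrefl H _))
  ... | at        | punched j =
    trans (neighbours j) (cong₂ (adj H) (sym (insert-self v u π₀)) (sym (π-punchIn j)))
  ... | punched i | at        =
    trans (Graph.sym G _ v) (trans (neighbours i)
      (trans (Graph.sym H u _) (cong₂ (adj H) (sym (π-punchIn i)) (sym (insert-self v u π₀)))))
  ... | punched i | punched j = trans (adj-iso i j) (cong₂ (adj H) (sym (π-punchIn i)) (sym (π-punchIn j)))

restrict : Subset (suc n) → Fin (suc n) → Subset n
restrict F v = tabulate (λ i → lookup F (punchIn v i))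

module _ {n} {F : Subset (suc n)} {v : Fin (suc n)} {i : Fin n} where

  ∈restrict⁺ : punchIn v i ∈ F → i ∈ restrict F v
  ∈restrict⁺ ∈F = lookup⇒[]= i _ (trans (lookup∘tabulate _ i) ([]=⇒lookup ∈F))

  ∈restrict⁻ : i ∈ restrict F v → punchIn v i ∈ F
  ∈restrict⁻ ∈R = lookup⇒[]= (punchIn v i) F (trans (sym (lookup∘tabulate _ i)) ([]=⇒lookup ∈R))

module _ {n} {F : Subset n} {v : Fin (suc n)} where

  ∉insertAt : v ∉ insertAt F v false
  ∉insertAt v∈ with trans (sym ([]=⇒lookup v∈)) (insertAt-lookup F v false)
  ... | ()

  ∈insertAt⁺ : {i : Fin n} → i ∈ F → punchIn v i ∈ insertAt F v false
  ∈insertAt⁺ {i} i∈F = lookup⇒[]= (punchIn v i) _ (trans (insertAt-punchIn F v false i) ([]=⇒lookup i∈F))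

  ∈insertAt⁻ : {i : Fin n} → punchIn v i ∈ insertAt F v false → i ∈ F
  ∈insertAt⁻ {i} ∈F′ = lookup⇒[]= i F (trans (sym (insertAt-punchIn F v false i)) ([]=⇒lookup ∈F′))

module _ {n} (G : Graph (suc n)) {v : Fin (suc n)} where

  restrict-isFort : {F : Subset (suc n)} → IsFort G F → v ∉ F → IsFort (G ─ v) (restrict F v)
  restrict-isFort {F} fort v∉F = ¬unique⇒isFort (G ─ v) nonempty λ {u} u∉ (w∈ , uw , unique) →
    isFort⇒¬unique G fort (u∉ ∘ ∈restrict⁺) (∈restrict⁻ w∈ , uw , λ {b} b∈F ub → lift b b∈F ub unique)
    where
    nonempty : Nonempty (restrict F v)
    nonempty with proj₁ fort
    ... | x , x∈F with punchView v x
    ...   | at        = ⊥-elim (v∉F x∈F)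
    ...   | punched i = i , ∈restrict⁺ x∈F
    lift : ∀ {u w} b → b ∈ F → Adj G (punchIn v u) b →
      (∀ {c} → c ∈ restrict F v → Adj (G ─ v) u c → c ≡ w) → b ≡ punchIn v w
    lift b b∈F ub unique with punchView v b
    ... | at        = ⊥-elim (v∉F b∈F)
    ... | punched c = cong (punchIn v) (unique (∈restrict⁺ b∈F) ub)

  lift-isFort : {F : Subset n} → IsFort (G ─ v) F → (∀ {i} → Adj G v (punchIn v i) → i ∉ F) →
    IsFort G (insertAt F v false)
  lift-isFort {F} fort v-outside = ¬unique⇒isFort G (Product.map (punchIn v) ∈insertAt⁺ (proj₁ fort)) noUnique
    where
    noUnique : ∀ {u w} → u ∉ insertAt F v false → ¬ UniqueNeighbourIn G (insertAt F v false) u w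
    noUnique {u} {w} u∉ (w∈ , uw , unique) with punchView v u | punchView v w
    ... | _         | at        = ∉insertAt w∈
    ... | at        | punched j = v-outside uw (∈insertAt⁻ w∈)
    ... | punched i | punched j = isFort⇒¬unique (G ─ v) fort (u∉ ∘ ∈insertAt⁺)
      (∈insertAt⁻ w∈ , uw , λ c∈F ic → punchIn-injective v _ _ (unique (∈insertAt⁺ c∈F) ic))

  inEveryFort-─ : InEveryFort G v → {w : Fin n} → Pendant G v (punchIn v w) → InEveryFort (G ─ v) w
  inEveryFort-─ v-anchor {w} (_ , unique) {F} fort with w ∈? F
  ... | yes w∈F = w∈F
  ... | no  w∉F = ⊥-elim (∉insertAt (v-anchor (lift-isFort fort λ vi i∈F →
    w∉F (subst (_∈ F) (punchIn-injective v _ _ (unique vi)) i∈F))))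

  inEveryFort-extend : {w : Fin n} → Pendant G v (punchIn v w) → InEveryFort (G ─ v) w → InEveryFort G v
  inEveryFort-extend pendant w-anchor {F} fort with v ∈? F
  ... | yes v∈F = v∈F
  ... | no  v∉F = ⊥-elim (v∉F (pendant-forces G pendant fort (∈restrict⁻ (w-anchor (restrict-isFort fort v∉F)))))

-- Graphs with a vertex in every fort are paths

anchor-pendant : (G : Graph (suc (suc n))) {v : Fin (suc (suc n))} → InEveryFort G v →
  ∃ λ w → Pendant G v (punchIn v w)
anchor-pendant G {v} v-anchor with pendant? G v
... | no ¬pendant = ⊥-elim (x∈p⇒x∉∁p (x∈⁅x⁆ v)
  (v-anchor (∁⁅x⁆-isFort G (punchInᵢ≢i v zero) (λ p → ¬pendant (_ , p)))))
... | yes (w , pendant) with punchView v w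
...   | at        = ⊥-elim (Adj⇒≢ G (proj₁ pendant) refl)
...   | punched i = i , pendant

inEveryFort⇒≅P : (G : Graph (suc n)) {v : Fin (suc n)} → InEveryFort G v →
  Σ (G ≅ P (suc n)) λ φ → _≅_.to φ v ≡ zero
inEveryFort⇒≅P {zero}  G {zero} _        = one-vertex-≅ G (P 1) , refl
-- The adjacency of P (2 + n) ─ zero is that of P (1 + n) by definition.
inEveryFort⇒≅P {suc n} G {v}    v-anchor = ≅-extend (≅-cong (λ _ _ → refl) ψ) neighbours
  where
  w = proj₁ (anchor-pendant G v-anchor)
  pendant = proj₂ (anchor-pendant G v-anchor)
  ψ-spec = inEveryFort⇒≅P (G ─ v) (inEveryFort-─ G v-anchor pendant)
  ψ = proj₁ ψ-spec
  open _≅_ ψ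
  neighbours : ∀ i → adj G v (punchIn v i) ≡ adj (P (suc (suc n))) zero (suc (to i))
  neighbours i with i ≟ w
  ... | yes refl = trans (proj₁ pendant) (cong (λ j → adj (P (suc (suc n))) zero (suc j)) (sym (proj₂ ψ-spec)))
  ... | no  i≢w  = trans (¬-not (i≢w ∘ punchIn-injective v i w ∘ proj₂ pendant)) (sym (not-first (to i) ψi≢0))
    where
    ψi≢0 : to i ≢ zero
    ψi≢0 ψi≡0 = i≢w (trans (sym (from-to i)) (trans (cong from (trans ψi≡0 (sym (proj₂ ψ-spec)))) (from-to w)))
    not-first : ∀ j → j ≢ zero → adj (P (suc (suc n))) zero (suc j) ≡ false
    not-first zero    j≢0 = ⊥-elim (j≢0 refl)
    not-first (suc j) _   = refl

-- Forts of paths and stars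

P-zero-pendant : Pendant (P (suc (suc n))) zero (suc zero)
P-zero-pendant = refl , λ { {zero} () ; {suc zero} _ → refl ; {suc (suc _)} () }

P-last-pendant : Pendant (P (suc (suc n))) (fromℕ (suc n)) (inject₁ (fromℕ n))
P-last-pendant {zero}  = refl , λ { {zero} _ → refl ; {suc zero} () }
P-last-pendant {suc n} =
  proj₁ (P-last-pendant {n}) , λ { {zero} () ; {suc b} lb → cong suc (proj₂ (P-last-pendant {n}) lb) }

punchIn-fromℕ : (i : Fin (suc n)) → punchIn (fromℕ (suc n)) i ≡ inject₁ i
punchIn-fromℕ         zero    = refl
punchIn-fromℕ {suc n} (suc i) = cong suc (punchIn-fromℕ i)

P─last-isFort : {F : Subset (suc n)} → IsFort (P (suc (suc n)) ─ fromℕ (suc n)) F → IsFort (P (suc n)) F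
P─last-isFort {n} = IsFort-cong {G = P (suc (suc n)) ─ fromℕ (suc n)} {H = P (suc n)} λ i j →
  trans (cong₂ (adj (P _)) (punchIn-fromℕ i) (punchIn-fromℕ j))
  (cong₂ (λ a b → (suc a ≡ᵇ b) ∨ (suc b ≡ᵇ a)) (toℕ-inject₁ i) (toℕ-inject₁ j))

P-zero-inEveryFort : InEveryFort (P (suc n)) zero
P-zero-inEveryFort {zero}  ((zero , 0∈F) , _) = 0∈F
P-zero-inEveryFort {suc n} = inEveryFort-extend (P (suc (suc n))) P-zero-pendant P-zero-inEveryFort

P-last-inEveryFort : InEveryFort (P (suc n)) (fromℕ n)
P-last-inEveryFort {zero}  = P-zero-inEveryFort
P-last-inEveryFort {suc n} = inEveryFort-extend (P (suc (suc n)))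
  (subst (Pendant (P _) (fromℕ (suc n))) (sym (punchIn-fromℕ (fromℕ n))) P-last-pendant)
  (λ fort → P-last-inEveryFort (P─last-isFort fort))

P-interior-neighbours : (b : Fin (suc k)) → b ≢ zero → b ≢ fromℕ k →
  ∃₂ λ a c → a ≢ c × Adj (P (suc k)) b a × Adj (P (suc k)) b c
P-interior-neighbours zero b≢0 _ = ⊥-elim (b≢0 refl)
P-interior-neighbours {suc zero} (suc zero) _ b≢last = ⊥-elim (b≢last refl)
P-interior-neighbours {suc (suc k)} (suc zero) _ _ = zero , suc (suc zero) , (λ ()) , refl , refl
P-interior-neighbours {suc (suc k)} (suc (suc b)) _ b≢last =
  let (a , c , a≢c , ba , bc) = P-interior-neighbours (suc b) (λ ()) (b≢last ∘ cong suc)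
  in suc a , suc c , a≢c ∘ suc-injective , ba , bc

P-interior-separates : {x y : Fin (suc k)} → y ≢ zero → y ≢ fromℕ k → x ≢ y → Separates (P (suc k)) x y
P-interior-separates {y = y} y≢0 y≢last = nonPendant⇒separates (P _) λ (_ , unique) →
  let (a , c , a≢c , ya , yc) = P-interior-neighbours y y≢0 y≢last in a≢c (trans (unique ya) (sym (unique yc)))

K1-leaf-pendant : (i : Fin n) → Pendant (K1 (suc n)) (suc i) zero
K1-leaf-pendant i = refl , λ { {zero} _ → refl ; {suc _} () }

K1-centre-comparable : ComparableToAll (K1 (suc n)) zero
K1-centre-comparable zero    = Incomparable-irrefl {G = K1 _}
K1-centre-comparable (suc z) = pendant⇒¬separates (K1 _) (K1-leaf-pendant z) ∘ proj₁

K1₃-leaves-comparable : ¬ Separates (K1 3) (suc zero) (suc (suc zero))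
K1₃-leaves-comparable (F , fort , 1∈F , 2∉F) with zero ∈? F
... | yes 0∈F = 2∉F (pendant-forces (K1 3) (K1-leaf-pendant (suc zero)) fort 0∈F)
... | no  0∉F = isFort⇒¬unique (K1 3) fort 0∉F (1∈F , refl , only-1)
  where
  only-1 : ∀ {b} → b ∈ F → Adj (K1 3) zero b → b ≡ suc zero
  only-1 {suc zero}       _   _ = refl
  only-1 {suc (suc zero)} 2∈F _ = ⊥-elim (2∉F 2∈F)

P-zero-comparable : ComparableToAll (P (suc n)) zero
P-zero-comparable {n} = inEveryFort⇒comparableToAll {G = P (suc n)} P-zero-inEveryFort

P-last-comparable : ComparableToAll (P (suc n)) (fromℕ n)
P-last-comparable {n} = inEveryFort⇒comparableToAll {G = P (suc n)} P-last-inEveryFort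

P-small-comparable : k ≤ 2 → (x : Fin (suc k)) → ComparableToAll (P (suc k)) x
P-small-comparable {k} _           zero             = P-zero-comparable {k}
P-small-comparable {k} _           (suc x)    zero  = P-zero-comparable {k} (suc x) ∘ Incomparable-sym {G = P (suc k)}
P-small-comparable (s≤s z≤n)       (suc zero)       = P-last-comparable {1}
P-small-comparable (s≤s (s≤s z≤n)) (suc (suc zero)) = P-last-comparable {2}
P-small-comparable (s≤s (s≤s z≤n)) (suc zero) (suc zero)       = Incomparable-irrefl {G = P 3}
P-small-comparable (s≤s (s≤s z≤n)) (suc zero) (suc (suc zero)) = P-last-comparable {2} (suc zero) ∘ Incomparable-sym {G = P 3}

K1-small-comparable : k ≤ 2 → (x : Fin (suc k)) → ComparableToAll (K1 (suc k)) x
K1-small-comparable {k} _           zero             = K1-centre-comparable {k}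
K1-small-comparable {k} _           (suc x)    zero  = K1-centre-comparable {k} (suc x) ∘ Incomparable-sym {G = K1 (suc k)}
K1-small-comparable (s≤s z≤n)       (suc zero) (suc zero)             = Incomparable-irrefl {G = K1 2}
K1-small-comparable (s≤s (s≤s z≤n)) (suc zero) (suc zero)             = Incomparable-irrefl {G = K1 3}
K1-small-comparable (s≤s (s≤s z≤n)) (suc zero) (suc (suc zero))       = K1₃-leaves-comparable ∘ proj₁
K1-small-comparable (s≤s (s≤s z≤n)) (suc (suc zero)) (suc zero)       = K1₃-leaves-comparable ∘ proj₂
K1-small-comparable (s≤s (s≤s z≤n)) (suc (suc zero)) (suc (suc zero)) = Incomparable-irrefl {G = K1 3}

three-cover : k ≤ 2 → {x w z : Fin (suc k)} → x ≢ w → x ≢ z → w ≢ z → ∀ u → u ≡ x ⊎ u ≡ w ⊎ u ≡ z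
three-cover k≤2 {x} {w} {z} x≢w x≢z w≢z u with u ≟ x | u ≟ w | u ≟ z
... | yes u≡x | _       | _       = inj₁ u≡x
... | no _    | yes u≡w | _       = inj₂ (inj₁ u≡w)
... | no _    | no _    | yes u≡z = inj₂ (inj₂ u≡z)
... | no u≢x  | no u≢w  | no u≢z  = ⊥-elim (collision (pigeonhole (s≤s (s≤s k≤2)) (lookup (x ∷ w ∷ z ∷ u ∷ []))))
  where
  collision : ¬ ∃₂ λ i j → i Fin.< j × lookup (x ∷ w ∷ z ∷ u ∷ []) i ≡ lookup (x ∷ w ∷ z ∷ u ∷ []) j
  collision (zero , suc zero , _ , eq)                         = x≢w eq
  collision (zero , suc (suc zero) , _ , eq)                   = x≢z eq
  collision (zero , suc (suc (suc zero)) , _ , eq)             = u≢x (sym eq)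
  collision (suc zero , suc (suc zero) , _ , eq)               = w≢z eq
  collision (suc zero , suc (suc (suc zero)) , _ , eq)         = u≢w (sym eq)
  collision (suc (suc zero) , suc (suc (suc zero)) , _ , eq)   = u≢z (sym eq)
  collision (zero , zero , () , _)
  collision (suc _ , zero , () , _)
  collision (suc zero , suc zero , s≤s () , _)
  collision (suc (suc _) , suc zero , s≤s () , _)
  collision (suc (suc zero) , suc (suc zero) , s≤s (s≤s ()) , _)
  collision (suc (suc (suc _)) , suc (suc zero) , s≤s (s≤s ()) , _)
  collision (suc (suc (suc zero)) , suc (suc (suc zero)) , s≤s (s≤s (s≤s ())) , _)

module _ {k} (k≤2 : k ≤ 2) (G : Graph (suc k)) (comparable : ∀ x → ComparableToAll G x) where

  -- If x ∉ F then its neighbour w ∉ F, and a third vertex z ∈ F is either the unique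
  -- neighbour of w in F or an isolated vertex, making x and z incomparable.
  pendant⇒inEveryFort : {x w : Fin (suc k)} → Pendant G x w → InEveryFort G x
  pendant⇒inEveryFort {x} {w} pendant {F} fort with x ∈? F
  ... | yes x∈F = x∈F
  ... | no  x∉F = ⊥-elim (stuck (proj₂ (proj₁ fort)))
    where
    w∉F : w ∉ F
    w∉F = x∉F ∘ pendant-forces G pendant fort
    stuck : ∀ {z} → z ∈ F → Data.Empty.⊥
    stuck {z} z∈F = by-adjacency (adj G w z) refl
      where
      x≢z : x ≢ z
      x≢z refl = x∉F z∈F
      w≢z : w ≢ z
      w≢z refl = w∉F z∈F
      cover = three-cover k≤2 (Adj⇒≢ G (proj₁ pendant)) x≢z w≢z
      by-adjacency : (b : Bool) → adj G w z ≡ b → Data.Empty.⊥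
      by-adjacency true wz = isFort⇒¬unique G fort w∉F (z∈F , wz , λ {b} b∈F wb →
        [ (λ { refl → ⊥-elim (x∉F b∈F) }) , [ (λ { refl → ⊥-elim (Adj⇒≢ G wb refl) }) , id ] ] (cover b))
      by-adjacency false wz = comparable x z
        (nonPendant⇒separates G (λ p → isolated (proj₁ p)) x≢z , (F , fort , z∈F , x∉F))
        where
        isolated : ∀ {b} → ¬ Adj G z b
        isolated {b} zb with cover b
        ... | inj₁ refl        = w≢z (sym (proj₂ pendant (Adj-sym G zb)))
        ... | inj₂ (inj₂ refl) = Adj⇒≢ G zb refl
        ... | inj₂ (inj₁ refl) with trans (sym wz) (Adj-sym G zb)
        ...   | ()

small-inEveryFort : k ≤ 2 → (G : Graph (suc k)) → (∀ x → ComparableToAll G x) → ∃ (InEveryFort G)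
small-inEveryFort {zero}  _   G _ = zero , λ { ((zero , 0∈F) , _) → 0∈F }
small-inEveryFort {suc k} k≤2 G comparable with pendant? G zero | pendant? G (suc zero)
... | yes (_ , p) | _           = zero , pendant⇒inEveryFort k≤2 G comparable p
... | no _        | yes (_ , p) = suc zero , pendant⇒inEveryFort k≤2 G comparable p
... | no ¬p₀      | no ¬p₁      = ⊥-elim (comparable zero (suc zero)
  (nonPendant⇒separates G (λ p → ¬p₁ (_ , p)) (λ ()) , nonPendant⇒separates G (λ p → ¬p₀ (_ , p)) (λ ())))

small⇒≅P : k ≤ 2 → (G : Graph (suc k)) → (∀ x → ComparableToAll G x) → G ≅ P (suc k)
small⇒≅P k≤2 G comparable = proj₁ (inEveryFort⇒≅P G (proj₂ (small-inEveryFort k≤2 G comparable)))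

-- Recognising paths and stars by their incomparable pairs

Interior : Fin n → Fin n → Fin n → Set
Interior e₁ e₂ y = y ≢ e₁ × y ≢ e₂

record PathProfile (G : Graph n) (e₁ e₂ : Fin n) : Set where
  field
    ends-distinct         : e₁ ≢ e₂
    e₁-comparable         : ComparableToAll G e₁
    e₂-comparable         : ComparableToAll G e₂
    interior-incomparable : ∀ {y y′} → Interior e₁ e₂ y → Interior e₁ e₂ y′ → y ≢ y′ → Incomparable G y y′
    y₁ y₂                 : Fin n
    y₁≢y₂                 : y₁ ≢ y₂
    y₁-interior           : Interior e₁ e₂ y₁
    y₂-interior           : Interior e₁ e₂ y₂

reverse : {G : Graph n} {e₁ e₂ : Fin n} → PathProfile G e₁ e₂ → PathProfile G e₂ e₁
reverse S = record
  { ends-distinct = ends-distinct ∘ sym ; e₁-comparable = e₂-comparable ; e₂-comparable = e₁-comparable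
  ; interior-incomparable = λ y y′ → interior-incomparable (Product.swap y) (Product.swap y′)
  ; y₁ = y₁ ; y₂ = y₂ ; y₁≢y₂ = y₁≢y₂
  ; y₁-interior = Product.swap y₁-interior ; y₂-interior = Product.swap y₂-interior
  }
  where open PathProfile S

module PathEnd {n} {G : Graph n} {e₁ e₂ : Fin n} (S : PathProfile G e₁ e₂) where
  open PathProfile S

  pendant-interior⇒end : ∀ {y w} → Interior e₁ e₂ y → Pendant G y w → w ≡ e₁ ⊎ w ≡ e₂
  pendant-interior⇒end {y} {w} y-interior pendant with w ≟ e₁ | w ≟ e₂
  ... | yes w≡e₁ | _        = inj₁ w≡e₁
  ... | no _     | yes w≡e₂ = inj₂ w≡e₂
  ... | no w≢e₁  | no w≢e₂  = ⊥-elim (pendant⇒¬separates G pendant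
    (proj₁ (interior-incomparable (w≢e₁ , w≢e₂) y-interior (Adj⇒≢ G (proj₁ pendant) ∘ sym))))

  another-interior : ∀ y → ∃ λ y′ → Interior e₁ e₂ y′ × y′ ≢ y
  another-interior y with y₁ ≟ y
  ... | yes refl = y₂ , y₂-interior , y₁≢y₂ ∘ sym
  ... | no  y₁≢y = y₁ , y₁-interior , y₁≢y

  -- Otherwise every other vertex z is pendant (else ∁ ⁅ z ⁆ separates e₁ from z), and then
  -- e₂, y₁ and y₂ are leaves at e₁, which makes e₂ and y₁ incomparable.
  e₁-pendant : ∃ (Pendant G e₁)
  e₁-pendant with pendant? G e₁
  ... | yes p = p
  ... | no ¬p = ⊥-elim (e₂-comparable y₁
    ( leaves-separable G e₂-leaf (leaf y₁-interior) (leaf y₂-interior) e₂≢y₁ e₂≢y₂ y₁≢y₂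
    , leaves-separable G (leaf y₁-interior) e₂-leaf (leaf y₂-interior) (e₂≢y₁ ∘ sym) y₁≢y₂ e₂≢y₂ ))
    where
    e₂≢y₁ = proj₂ y₁-interior ∘ sym
    e₂≢y₂ = proj₂ y₂-interior ∘ sym
    all-pendant : ∀ {z} → z ≢ e₁ → ∃ (Pendant G z)
    all-pendant {z} z≢e₁ with pendant? G z
    ... | yes p  = p
    ... | no ¬pᶻ = ⊥-elim (e₁-comparable z
      ( nonPendant⇒separates G (λ p → ¬pᶻ (_ , p)) (z≢e₁ ∘ sym)
      , nonPendant⇒separates G (λ p → ¬p (_ , p)) z≢e₁ ))
    leaf : ∀ {y} → Interior e₁ e₂ y → Pendant G y e₁
    leaf {y} y-interior with all-pendant (proj₁ y-interior)
    ... | w , pʸ with pendant-interior⇒end y-interior pʸ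
    ...   | inj₁ refl = pʸ
    ...   | inj₂ refl = ⊥-elim (e₂-comparable e₁
      (component-incomparable G e₂-at-y pʸ ends-distinct (proj₁ y-interior ∘ sym)))
      where
      e₂-at-y : Pendant G e₂ y
      e₂-at-y = let (_ , pᵉ) = all-pendant (ends-distinct ∘ sym) in
        subst (Pendant G e₂) (sym (proj₂ pᵉ (Adj-sym G (proj₁ pʸ)))) pᵉ
    e₂-leaf : Pendant G e₂ e₁
    e₂-leaf with all-pendant (ends-distinct ∘ sym)
    ... | u , pᵘ with u ≟ e₁
    ...   | yes refl = pᵘ
    ...   | no  u≢e₁ =
      ⊥-elim (ends-distinct (sym (proj₂ (leaf (u≢e₁ , Adj⇒≢ G (proj₁ pᵘ) ∘ sym)) (Adj-sym G (proj₁ pᵘ)))))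

  ¬pendant-at-e₁ : ∀ {y} → Interior e₁ e₂ y → ¬ Pendant G y e₁
  ¬pendant-at-e₁ {y} y-interior pʸ with another-interior y | e₁-pendant
  ... | y′ , (y′≢e₁ , _) , y′≢y | _ , pᵉ = e₁-comparable y′ (component-incomparable G e₁-at-y pʸ y′≢e₁ y′≢y)
    where
    e₁-at-y : Pendant G e₁ y
    e₁-at-y = subst (Pendant G e₁) (sym (proj₂ pᵉ (Adj-sym G (proj₁ pʸ)))) pᵉ

module PathAnchor {n} {G : Graph n} {e₁ e₂ : Fin n} (S : PathProfile G e₁ e₂) where
  open PathProfile S
  open PathEnd S
  open PathEnd (reverse S) using () renaming (¬pendant-at-e₁ to ¬pendant-at-e₂)

  interior-nonPendant : ∀ {y w} → Interior e₁ e₂ y → ¬ Pendant G y w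
  interior-nonPendant y-interior p with pendant-interior⇒end y-interior p
  ... | inj₁ refl = ¬pendant-at-e₁ y-interior p
  ... | inj₂ refl = ¬pendant-at-e₂ (Product.swap y-interior) p

  interior-below-e₁ : ∀ {y} → Interior e₁ e₂ y → ¬ Separates G y e₁
  interior-below-e₁ y-interior y-sep = e₁-comparable _
    (nonPendant⇒separates G (interior-nonPendant y-interior) (proj₁ y-interior ∘ sym) , y-sep)

  -- A fort avoiding e₁ could only be {e₂}, forcing e₂ to be isolated.
  e₁-inEveryFort : InEveryFort G e₁
  e₁-inEveryFort {F} fort with e₁ ∈? F
  ... | yes e₁∈F = e₁∈F
  ... | no  e₁∉F = ⊥-elim (e₂-comparable y₁
    ( (F , fort , e₂∈F , proj₂ y₁-interior ∘ only-e₂)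
    , nonPendant⇒separates G (λ p → e₂-isolated (proj₁ p)) (proj₂ y₁-interior) ))
    where
    only-e₂ : ∀ {x} → x ∈ F → x ≡ e₂
    only-e₂ {x} x∈F with x ≟ e₁ | x ≟ e₂
    ... | yes refl | _        = ⊥-elim (e₁∉F x∈F)
    ... | no _     | yes x≡e₂ = x≡e₂
    ... | no x≢e₁  | no x≢e₂  = ⊥-elim (interior-below-e₁ (x≢e₁ , x≢e₂) (F , fort , x∈F , e₁∉F))
    e₂∈F : e₂ ∈ F
    e₂∈F = let (x , x∈F) = proj₁ fort in subst (_∈ F) (only-e₂ x∈F) x∈F
    e₂-isolated : ∀ {u} → ¬ Adj G e₂ u
    e₂-isolated {u} e₂u = isFort⇒¬unique G fort (λ u∈F → Adj⇒≢ G e₂u (sym (only-e₂ u∈F)))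
      (e₂∈F , Adj-sym G e₂u , λ b∈F _ → only-e₂ b∈F)

record StarProfile (G : Graph n) (c : Fin n) : Set where
  field
    centre-comparable   : ComparableToAll G c
    leaves-incomparable : ∀ {y y′} → y ≢ c → y′ ≢ c → y ≢ y′ → Incomparable G y y′
    y₁ y₂               : Fin n
    y₁≢y₂               : y₁ ≢ y₂
    y₁≢c                : y₁ ≢ c
    y₂≢c                : y₂ ≢ c

module Star {n} {G : Graph (suc (suc n))} {c : Fin (suc (suc n))} (S : StarProfile G c) where
  open StarProfile S

  pendant-leaf⇒centre : ∀ {y w} → y ≢ c → Pendant G y w → w ≡ c
  pendant-leaf⇒centre {y} {w} y≢c pendant with w ≟ c
  ... | yes w≡c = w≡c
  ... | no  w≢c = ⊥-elim (pendant⇒¬separates G pendant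
    (proj₁ (leaves-incomparable w≢c y≢c (Adj⇒≢ G (proj₁ pendant) ∘ sym))))

  another-leaf : ∀ w → ∃ λ z → z ≢ c × z ≢ w
  another-leaf w with y₁ ≟ w
  ... | yes refl = y₂ , y₂≢c , y₁≢y₂ ∘ sym
  ... | no  y₁≢w = y₁ , y₁≢c , y₁≢w

  -- A pendant centre would lie in every fort, so G would be a path starting at c whose
  -- other end is pendant at c, making {c, w} a K₂ component.
  ¬centre-pendant : ∀ {w} → ¬ Pendant G c w
  ¬centre-pendant {w} pᶜ with another-leaf w
  ... | z , z≢c , z≢w = centre-comparable z (component-incomparable G pᶜ pʷ z≢c z≢w)
    where
    w≢c = Adj⇒≢ G (proj₁ pᶜ) ∘ sym
    c-inEveryFort : InEveryFort G c
    c-inEveryFort {F} fort with c ∈? F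
    ... | yes c∈F = c∈F
    ... | no  c∉F = ⊥-elim (stuck (proj₂ (proj₁ fort)))
      where
      stuck : ∀ {x} → x ∈ F → Data.Empty.⊥
      stuck {x} x∈F with x ≟ c | x ≟ w
      ... | yes refl | _        = c∉F x∈F
      ... | no _     | yes refl = c∉F (pendant-forces G pᶜ fort x∈F)
      ... | no x≢c   | no x≢w   = centre-comparable x (c-separates-x , (F , fort , x∈F , c∉F))
        where
        c-separates-x : Separates G c x
        c-separates-x with proj₁ (leaves-incomparable w≢c x≢c (x≢w ∘ sym))
        ... | F′ , fort′ , w∈F′ , x∉F′ = F′ , fort′ , pendant-forces G pᶜ fort′ w∈F′ , x∉F′
    φ-spec = inEveryFort⇒≅P G c-inEveryFort
    open _≅_ (proj₁ φ-spec)
    ℓ = from (fromℕ (suc n))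
    pˡ = pendant-from (proj₁ φ-spec) (P-last-pendant {n})
    ℓ≢c : ℓ ≢ c
    ℓ≢c ℓ≡c with trans (sym (to-from (fromℕ (suc n)))) (trans (cong to ℓ≡c) (proj₂ φ-spec))
    ... | ()
    ℓ-at-c = subst (Pendant G ℓ) (pendant-leaf⇒centre ℓ≢c pˡ) pˡ
    pʷ : Pendant G w c
    pʷ = subst (λ v → Pendant G v c) (proj₂ pᶜ (Adj-sym G (proj₁ ℓ-at-c))) ℓ-at-c

  leaf-pendant : ∀ {y} → y ≢ c → Pendant G y c
  leaf-pendant {y} y≢c with pendant? G y
  ... | yes (w , p) = subst (Pendant G y) (pendant-leaf⇒centre y≢c p) p
  ... | no  ¬p      = ⊥-elim (centre-comparable y
    (nonPendant⇒separates G (λ p → ¬p (_ , p)) (y≢c ∘ sym) , nonPendant⇒separates G ¬centre-pendant y≢c))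

  adj-star : ∀ u v → adj G u v ≡ does (u ≟ c) xor does (v ≟ c)
  adj-star u v with u ≟ c | v ≟ c
  ... | yes refl | yes refl = irrefl G u
  ... | yes refl | no  v≢c  = Adj-sym G (proj₁ (leaf-pendant v≢c))
  ... | no  u≢c  | yes refl = proj₁ (leaf-pendant u≢c)
  ... | no  u≢c  | no  v≢c  = ¬-not (v≢c ∘ proj₂ (leaf-pendant u≢c))

K1-adj : ∀ (a b : Fin (suc n)) → adj (K1 (suc n)) a b ≡ does (a ≟ zero) xor does (b ≟ zero)
K1-adj zero    zero    = refl
K1-adj zero    (suc b) = refl
K1-adj (suc a) zero    = refl
K1-adj (suc a) (suc b) = refl

does-≟-permutation : (π : Permutation m n) (u v : Fin m) → does (u ≟ v) ≡ does (π ⟨$⟩ʳ u ≟ π ⟨$⟩ʳ v)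
does-≟-permutation π u v with u ≟ v | π ⟨$⟩ʳ u ≟ π ⟨$⟩ʳ v
... | yes refl | yes _     = refl
... | yes refl | no  πu≢πu = ⊥-elim (πu≢πu refl)
... | no  _    | no  _     = refl
... | no  u≢v  | yes πu≡πv =
  ⊥-elim (u≢v (trans (sym (inverseˡ π)) (trans (cong (π ⟨$⟩ˡ_) πu≡πv) (inverseˡ π))))

starProfile⇒≅K1 : {G : Graph (suc (suc n))} {c : Fin (suc (suc n))} (π : Permutation (suc (suc n)) (suc (suc n))) →
  π ⟨$⟩ʳ c ≡ zero → StarProfile G c → G ≅ K1 (suc (suc n))
starProfile⇒≅K1 {n} {G} {c} π πc≡0 S = mk≅ π λ u v → begin
  adj G u v                                               ≡⟨ Star.adj-star S u v ⟩
  does (u ≟ c) xor does (v ≟ c)                       ≡⟨ cong₂ _xor_ (is-centre u) (is-centre v) ⟩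
  does (π ⟨$⟩ʳ u ≟ zero) xor does (π ⟨$⟩ʳ v ≟ zero)  ≡⟨ sym (K1-adj (π ⟨$⟩ʳ u) (π ⟨$⟩ʳ v)) ⟩
  adj (K1 (suc (suc n))) (π ⟨$⟩ʳ u) (π ⟨$⟩ʳ v)        ∎
  where
  open ≡-Reasoning
  is-centre : ∀ u → does (u ≟ c) ≡ does (π ⟨$⟩ʳ u ≟ zero)
  is-centre u = trans (does-≟-permutation π u c) (cong (λ z → does (π ⟨$⟩ʳ u ≟ z)) πc≡0)

module _ {G : Graph m} {H : Graph n} (φ : IncIso G H) where
  open IncIso φ
  private
    to   = bijection ⟨$⟩ʳ_
    from = bijection ⟨$⟩ˡ_

  to-injective : ∀ {x y} → to x ≡ to y → x ≡ y
  to-injective {x} {y} eq = trans (sym (inverseˡ bijection)) (trans (cong from eq) (inverseˡ bijection))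

  from-injective : ∀ {a b} → from a ≡ from b → a ≡ b
  from-injective {a} {b} eq = trans (sym (inverseʳ bijection)) (trans (cong to eq) (inverseʳ bijection))

  to-≢ : ∀ {x a} → x ≢ from a → to x ≢ a
  to-≢ x≢ eq = x≢ (trans (sym (inverseˡ bijection)) (cong from eq))

  from-comparable : ∀ {e} → ComparableToAll H e → ComparableToAll G (from e)
  from-comparable e-comparable z x≁z =
    e-comparable (to z) (subst (λ a → Incomparable H a (to z)) (inverseʳ bijection) (preserves x≁z))

  incomparable-from : ∀ {x y} → Incomparable H (to x) (to y) → Incomparable G x y
  incomparable-from x≁y = subst₂ (Incomparable G) (inverseˡ bijection) (inverseˡ bijection) (reflects x≁y)

  all-comparable : (∀ a → ComparableToAll H a) → ∀ x → ComparableToAll G x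
  all-comparable comparable x y = comparable (to x) (to y) ∘ preserves

small-or-large : (k : ℕ) → k ≤ 2 ⊎ ∃ λ j → k ≡ suc (suc (suc j))
small-or-large zero                = inj₁ z≤n
small-or-large (suc zero)          = inj₁ (s≤s z≤n)
small-or-large (suc (suc zero))    = inj₁ (s≤s (s≤s z≤n))
small-or-large (suc (suc (suc j))) = inj₂ (j , refl)

incIso⇒≅P : {G : Graph (suc m)} → IncIso G (P (suc k)) → G ≅ P (suc k)
incIso⇒≅P {k = k} {G} φ with ↔⇒≡ (IncIso.bijection φ) | small-or-large k
... | refl | inj₁ k≤2        = small⇒≅P k≤2 G (all-comparable φ (P-small-comparable k≤2))
... | refl | inj₂ (j , refl) = proj₁ (inEveryFort⇒≅P G (PathAnchor.e₁-inEveryFort profile))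
  where
  from = IncIso.bijection φ ⟨$⟩ˡ_
  profile : PathProfile G (from zero) (from (fromℕ (suc (suc (suc j)))))
  profile = record
    { ends-distinct = (λ ()) ∘ from-injective φ
    ; e₁-comparable = from-comparable φ P-zero-comparable
    ; e₂-comparable = from-comparable φ P-last-comparable
    ; interior-incomparable = λ (y≢e₁ , y≢e₂) (y′≢e₁ , y′≢e₂) y≢y′ → incomparable-from φ
        ( P-interior-separates (to-≢ φ y′≢e₁) (to-≢ φ y′≢e₂) (y≢y′ ∘ to-injective φ)
        , P-interior-separates (to-≢ φ y≢e₁) (to-≢ φ y≢e₂) (y≢y′ ∘ sym ∘ to-injective φ) )
    ; y₁ = from (suc zero) ; y₂ = from (suc (suc zero))
    ; y₁≢y₂ = (λ ()) ∘ from-injective φ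
    ; y₁-interior = (λ ()) ∘ from-injective φ , (λ ()) ∘ from-injective φ
    ; y₂-interior = (λ ()) ∘ from-injective φ , (λ ()) ∘ from-injective φ
    }

K1-leaf : {a : Fin (suc n)} → a ≢ zero → Pendant (K1 (suc n)) a zero
K1-leaf {a = zero}  a≢0 = ⊥-elim (a≢0 refl)
K1-leaf {a = suc a} _   = K1-leaf-pendant a

third-leaf : (a b : Fin (suc (suc (suc (suc n))))) → ∃ λ d → d ≢ zero × d ≢ a × d ≢ b
third-leaf a b with suc zero ≟ a | suc zero ≟ b
... | no 1≢a   | no 1≢b = suc zero , (λ ()) , 1≢a , 1≢b
... | yes refl | _ with suc (suc zero) ≟ b
...   | no 2≢b   = suc (suc zero) , (λ ()) , (λ ()) , 2≢b
...   | yes refl = suc (suc (suc zero)) , (λ ()) , (λ ()) , (λ ())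
third-leaf a b | no _ | yes refl with suc (suc zero) ≟ a
...   | no 2≢a   = suc (suc zero) , (λ ()) , 2≢a , (λ ())
...   | yes refl = suc (suc (suc zero)) , (λ ()) , (λ ()) , (λ ())

K1-leaves-incomparable : {a b : Fin (suc (suc (suc (suc n))))} →
  a ≢ zero → b ≢ zero → a ≢ b → Incomparable (K1 _) a b
K1-leaves-incomparable {a = a} {b} a≢0 b≢0 a≢b with third-leaf a b
... | d , d≢0 , d≢a , d≢b =
  leaves-separable (K1 _) (K1-leaf a≢0) (K1-leaf b≢0) (K1-leaf d≢0) a≢b (d≢a ∘ sym) (d≢b ∘ sym) ,
  leaves-separable (K1 _) (K1-leaf b≢0) (K1-leaf a≢0) (K1-leaf d≢0) (a≢b ∘ sym) (d≢b ∘ sym) (d≢a ∘ sym)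

incIso⇒≅K1 : {G : Graph (suc m)} → IncIso G (K1 (suc k)) → G ≅ K1 (suc k)
incIso⇒≅K1 {k = k} {G} φ with ↔⇒≡ (IncIso.bijection φ) | small-or-large k
... | refl | inj₁ k≤2 = ≅-trans (small⇒≅P k≤2 G (all-comparable φ (K1-small-comparable k≤2)))
                                (≅-sym (small⇒≅P k≤2 (K1 _) (K1-small-comparable k≤2)))
... | refl | inj₂ (j , refl) = starProfile⇒≅K1 π (inverseʳ π) profile
  where
  π = IncIso.bijection φ
  from = π ⟨$⟩ˡ_
  profile : StarProfile G (from zero)
  profile = record
    { centre-comparable   = from-comparable φ K1-centre-comparable
    ; leaves-incomparable = λ y≢c y′≢c y≢y′ →
        incomparable-from φ (K1-leaves-incomparable (to-≢ φ y≢c) (to-≢ φ y′≢c) (y≢y′ ∘ to-injective φ))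
    ; y₁ = from (suc zero) ; y₂ = from (suc (suc zero))
    ; y₁≢y₂ = (λ ()) ∘ from-injective φ
    ; y₁≢c  = (λ ()) ∘ from-injective φ
    ; y₂≢c  = (λ ()) ∘ from-injective φ
    }

zirIso⇒≅ : (H : Graph (suc k)) → ComparableToAll H zero → (∀ {m} {G : Graph (suc m)} → IncIso G H → G ≅ H) →
  (m : ℕ) (G : Graph (suc m)) → ZirIso G H → G ≅ H
zirIso⇒≅ {zero}  H _ _ zero G _ = one-vertex-≅ G H
zirIso⇒≅ {suc k} H _ recognise zero G I =
  recognise (IncIso-flip (zirIso⇒incIso (inverse I) {zero} {suc zero} (λ ()) (one-vertex-comparable G)))
zirIso⇒≅ H zero-comparable recognise (suc m) G I =
  recognise (zirIso⇒incIso I {zero} {suc zero} (λ ()) zero-comparable)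

proposition8p27 : (k : ℕ) →
    ((m : ℕ) (G : Graph (suc m)) → ZirIso G (P (suc k)) → G ≅ P (suc k))
    × ((m : ℕ) (G : Graph (suc m)) → ZirIso G (K1 (suc k)) → G ≅ K1 (suc k))
proposition8p27 k =
  zirIso⇒≅ (P (suc k)) P-zero-comparable incIso⇒≅P , zirIso⇒≅ (K1 (suc k)) K1-centre-comparable incIso⇒≅K1
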